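{- For every finite connected simple graph $G$ with $m$ edges and minimum degree $\delta$, $\widetilde{\mathsf{VC}}(G)\ge m-\delta$.
   Context: Unweighted deterministic walk: each vertex $u$ has a rotor sequence of length $\tilde d(u)$ of neighbours of $u$, each occurring exactly $\tilde d(u)/\deg(u)$ times (e.g. $\tilde d(u)=\deg(u)$ and the sequence is a permutation of the neighbours), and an initial rotor position. The walk moves from the current vertex $\tilde x_t$ to the vertex the rotor of $\tilde x_t$ points at, and then advances that rotor cyclically to the next entry of its sequence. $\widetilde{\mathsf{VC}}(G)$ is the maximum over start vertices $\tilde x_0$ and over all rotor sequences and initial rotor positions (lengths fixed) of the least $t\ge0$ with $\{\tilde x_0,\dots,\tilde x_t\}=V$. -}

module Defs where

open import Data.Nat using (ℕ; zero; suc; _+_; _*_; _≤_; _<_; _<ᵇ_; _%_)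
open import Data.Nat.DivMod using (m%n<n)
open import Data.Fin using (Fin; toℕ; fromℕ<; _≟_)
open import Data.Bool using (Bool; true; false; if_then_else_; _∧_)
open import Data.Product using (Σ; ∃; _×_; _,_)
open import Relation.Nullary using (¬_; yes; no)
open import Relation.Nullary.Decidable using (⌊_⌋)
open import Relation.Binary.PropositionalEquality using (_≡_; refl)

count : ∀ {n} → (Fin n → Bool) → ℕ
count {zero}  p = 0
count {suc n} p = (if p Fin.zero then 1 else 0) + count (λ i → p (Fin.suc i))

sumF : ∀ {n} → (Fin n → ℕ) → ℕ
sumF {zero}  f = 0
sumF {suc n} f = f Fin.zero + sumF (λ i → f (Fin.suc i))

record SimpleGraph (n : ℕ) : Set where
  field
    adj    : Fin n → Fin n → Bool
    sym    : ∀ u v → adj u v ≡ adj v u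
    irrefl : ∀ u → adj u u ≡ false
open SimpleGraph public

module _ {n : ℕ} (G : SimpleGraph n) where

  deg : Fin n → ℕ
  deg u = count (adj G u)

  edgeCount : ℕ
  edgeCount = sumF (λ i → count (λ j → adj G i j ∧ (toℕ i <ᵇ toℕ j)))

  IsMinDegree : ℕ → Set
  IsMinDegree δ = (∃ λ u → deg u ≡ δ) × (∀ u → δ ≤ deg u)

  data Reachable : Fin n → Fin n → Set where
    here  : ∀ {u} → Reachable u u
    there : ∀ {u v w} → adj G u v ≡ true → Reachable v w → Reachable u w

  Connected : Set
  Connected = ∀ u v → Reachable u v

  -- Rotor configuration: every vertex u has a rotor sequence of length
  -- len u = k u * deg u in which every neighbour of u occurs exactly k u
  -- times (= len u / deg u) and no non-neighbour occurs.
  module Rotor (k : Fin n → ℕ) where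

    len : Fin n → ℕ
    len u = k u * deg u

    RotorSeqs : Set
    RotorSeqs = (u : Fin n) → Fin (len u) → Fin n

    ValidSeqs : RotorSeqs → Set
    ValidSeqs σ = ∀ u v →
      count (λ i → ⌊ σ u i ≟ v ⌋) ≡ (if adj G u v then k u else 0)

    Positions : Set
    Positions = (u : Fin n) → Fin (len u)

    advance : ∀ {L} → Fin L → Fin L
    advance {suc L} i = fromℕ< (m%n<n (suc (toℕ i)) (suc L))

    advanceAt : Fin n → Positions → Positions
    advanceAt x ρ w with w ≟ x
    ... | yes refl = advance (ρ w)
    ... | no  _    = ρ w

    State : Set
    State = Fin n × Positions

    step : RotorSeqs → State → State
    step σ (x , ρ) = σ x (ρ x) , advanceAt x ρ

    walkState : RotorSeqs → State → ℕ → State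
    walkState σ s zero    = s
    walkState σ s (suc t) = step σ (walkState σ s t)

    position : RotorSeqs → State → ℕ → Fin n
    position σ s t = Data.Product.proj₁ (walkState σ s t)

    CoveredBy : RotorSeqs → State → ℕ → Set
    CoveredBy σ s t = ∀ v → ∃ λ r → r ≤ t × position σ s r ≡ v

  -- VC~(G) ≥ c for rotor lengths k u * deg u: some start vertex and some
  -- valid rotor sequences / initial positions whose cover time (least t with
  -- {x̃_0,…,x̃_t} = V) is at least c, i.e. V is not covered at any time t < c.
  VCAtLeast : (k : Fin n → ℕ) → ℕ → Set
  VCAtLeast k c =
    Σ (Rotor.RotorSeqs k) λ σ → Rotor.ValidSeqs k σ ×
    Σ (Rotor.State k) λ s → ∀ t → t < c → ¬ Rotor.CoveredBy k σ s t

module Submission where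

-- We prove the stronger
-- bound m (whenever m ≥ 1) and weaken it at the end.
--
-- A walk that traverses no directed edge twice can be followed by a rotor
-- walk: at each vertex list first the walk's successors, then the remaining
-- neighbours (module Realisation).  Such a walk is grown from an endpoint x₀
-- of an edge by inserting excursions a → b → a along untraversed edges leaving
-- the visited set (module Growth), until every edge between visited vertices
-- is traversed in both directions and exactly one vertex w is unvisited.
-- Counting traversals gives 2m ≤ length + 2 deg w, and as every new vertex
-- cost two steps, deg w ≤ #visited ≤ 1 + length/2; so m ≤ 1 + length, and the
-- rotor walk has not reached w at any time t < m.

open import Defs hiding (sym)
open import Data.Nat using (ℕ; zero; suc; _+_; _*_; _∸_; _≤_; _<_; _<ᵇ_; _≤?_; z≤n; s≤s; s≤s⁻¹)
open import Data.Nat.Properties hiding (_≟_)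
open import Data.Nat.DivMod using (m%n<n; m<n⇒m%n≡m)
open import Data.Fin using (Fin; toℕ; fromℕ<; _≟_) renaming (zero to fz; suc to fs)
open import Data.Fin.Properties using (toℕ-fromℕ<; any?)
open import Data.Bool using (Bool; true; false; if_then_else_; _∧_; _∨_; not)
open import Data.Bool.Properties using (∧-comm; ∧-identityʳ)
open import Data.List using (List; []; _∷_; _++_; length; map)
open import Data.List.Properties using (length-++)
open import Data.Product using (∃; _×_; _,_; proj₁)
open import Data.Sum using (_⊎_; inj₁; inj₂)
open import Data.Unit using (⊤; tt)
open import Data.Empty using (⊥-elim)
open import Relation.Nullary using (¬_; Dec; yes; no)
open import Relation.Nullary.Decidable using (⌊_⌋; _×-dec_)
open import Relation.Binary.PropositionalEquality
open import Algebra.Properties.CommutativeSemigroup +-commutativeSemigroup using (interchange; x∙yz≈y∙xz)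
import Data.Bool as Bool
import Data.Nat as ℕ

true≢false : ¬ true ≡ false
true≢false ()

ind : Bool → ℕ
ind b = if b then 1 else 0

ind≤1 : ∀ b → ind b ≤ 1
ind≤1 true  = ≤-refl
ind≤1 false = z≤n

0<ᵇ-+ : ∀ p q → (0 <ᵇ (p + q)) ≡ ((0 <ᵇ p) ∨ (0 <ᵇ q))
0<ᵇ-+ zero    q = refl
0<ᵇ-+ (suc p) q = refl

0<ᵇ⇒1≤ : ∀ {k} → (0 <ᵇ k) ≡ true → 1 ≤ k
0<ᵇ⇒1≤ {suc k} _ = s≤s z≤n

1≤⇒0<ᵇ : ∀ {k} → 1 ≤ k → (0 <ᵇ k) ≡ true
1≤⇒0<ᵇ {suc k} _ = refl

0<ᵇ-ind : ∀ c → (0 <ᵇ ind c) ≡ c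
0<ᵇ-ind true  = refl
0<ᵇ-ind false = refl

halve : ∀ m k → m + m ≤ k + k → m ≤ k
halve zero    k       h = z≤n
halve (suc m) zero    ()
halve (suc m) (suc k) h rewrite +-suc m m | +-suc k k = s≤s (halve m k (s≤s⁻¹ (s≤s⁻¹ h)))

sumF-ext : ∀ {n} {f g : Fin n → ℕ} → (∀ i → f i ≡ g i) → sumF f ≡ sumF g
sumF-ext {zero}  e = refl
sumF-ext {suc n} e = cong₂ _+_ (e fz) (sumF-ext (λ i → e (fs i)))

sumF-mono : ∀ {n} {f g : Fin n → ℕ} → (∀ i → f i ≤ g i) → sumF f ≤ sumF g
sumF-mono {zero}  e = z≤n
sumF-mono {suc n} e = +-mono-≤ (e fz) (sumF-mono (λ i → e (fs i)))

sumF-+ : ∀ {n} (f g : Fin n → ℕ) → sumF (λ i → f i + g i) ≡ sumF f + sumF g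
sumF-+ {zero}  f g = refl
sumF-+ {suc n} f g =
  trans (cong (f fz + g fz +_) (sumF-+ (λ i → f (fs i)) (λ i → g (fs i))))
        (interchange (f fz) (g fz) _ _)

sumF-* : ∀ {n} (c : ℕ) (f : Fin n → ℕ) → sumF (λ i → c * f i) ≡ c * sumF f
sumF-* {zero}  c f = sym (*-zeroʳ c)
sumF-* {suc n} c f =
  trans (cong (c * f fz +_) (sumF-* c (λ i → f (fs i)))) (sym (*-distribˡ-+ c (f fz) _))

sumF-const : ∀ {n} (c : ℕ) → sumF {n} (λ _ → c) ≡ n * c
sumF-const {zero}  c = refl
sumF-const {suc n} c = cong (c +_) (sumF-const {n} c)

sumF-zero : ∀ {n} → sumF {n} (λ _ → 0) ≡ 0
sumF-zero {n} = trans (sumF-const {n} 0) (*-zeroʳ n)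

sumF-swap : ∀ {n m} (f : Fin n → Fin m → ℕ) →
  sumF (λ i → sumF (λ j → f i j)) ≡ sumF (λ j → sumF (λ i → f i j))
sumF-swap {zero}  {m} f = sym (sumF-zero {m})
sumF-swap {suc n} {m} f =
  trans (cong (sumF (f fz) +_) (sumF-swap (λ i → f (fs i))))
        (sym (sumF-+ (f fz) (λ j → sumF (λ i → f (fs i) j))))

sumF-pos : ∀ {n} (f : Fin n → ℕ) → 1 ≤ sumF f → ∃ λ i → 1 ≤ f i
sumF-pos {suc n} f h with f fz in eq
... | suc _ = fz , subst (1 ≤_) (sym eq) (s≤s z≤n)
... | zero with sumF-pos (λ i → f (fs i)) h
...   | i , p = fs i , p

count≡sumF : ∀ {n} (p : Fin n → Bool) → count p ≡ sumF (λ i → ind (p i))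
count≡sumF {zero}  p = refl
count≡sumF {suc n} p = cong (ind (p fz) +_) (count≡sumF (λ i → p (fs i)))

count-ext : ∀ {n} {p q : Fin n → Bool} → (∀ i → p i ≡ q i) → count p ≡ count q
count-ext {zero}  e = refl
count-ext {suc n} e = cong₂ _+_ (cong ind (e fz)) (count-ext (λ i → e (fs i)))

count-pos : ∀ {n} (p : Fin n → Bool) → 1 ≤ count p → ∃ λ i → p i ≡ true
count-pos {suc n} p h with p fz in eq
... | true = fz , eq
... | false with count-pos (λ i → p (fs i)) h
...   | i , q = fs i , q

count≤ : ∀ {n} (p : Fin n → Bool) → count p ≤ n
count≤ {zero}  p = z≤n
count≤ {suc n} p = +-mono-≤ (ind≤1 (p fz)) (count≤ (λ i → p (fs i)))

count-lt : ∀ {n} (p : Fin n → Bool) → count p < n → ∃ λ i → p i ≡ false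
count-lt {suc n} p h with p fz in eq
... | false = fz , eq
... | true with count-lt (λ i → p (fs i)) (s≤s⁻¹ h)
...   | i , q = fs i , q

count-false : ∀ {n} (p : Fin n → Bool) i → p i ≡ false → 1 + count p ≤ n
count-false p fz e rewrite e = s≤s (count≤ _)
count-false p (fs i) e =
  ≤-trans (+-monoʳ-≤ 1 (+-monoˡ-≤ _ (ind≤1 (p fz)))) (s≤s (count-false (λ j → p (fs j)) i e))

count-true : ∀ {n} (p : Fin n → Bool) i → p i ≡ true → 1 ≤ count p
count-true p fz e rewrite e = s≤s z≤n
count-true p (fs i) e = ≤-trans (count-true (λ j → p (fs j)) i e) (m≤n+m _ (ind (p fz)))

count-false₂ : ∀ {n} (p : Fin n → Bool) i j → ¬ i ≡ j → p i ≡ false → p j ≡ false →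
  2 + count p ≤ n
count-false₂ p fz     fz     i≢j _  _  = ⊥-elim (i≢j refl)
count-false₂ p fz     (fs j) _   ei ej rewrite ei = s≤s (count-false (λ k → p (fs k)) j ej)
count-false₂ p (fs i) fz     _   ei ej rewrite ej = s≤s (count-false (λ k → p (fs k)) i ei)
count-false₂ p (fs i) (fs j) i≢j ei ej =
  ≤-trans (+-monoʳ-≤ 2 (+-monoˡ-≤ _ (ind≤1 (p fz))))
          (s≤s (count-false₂ (λ k → p (fs k)) i j (λ e → i≢j (cong fs e)) ei ej))

-- Boolean equality on Fin, by structural recursion so that it computes on
-- constructors.
_==_ : ∀ {n} → Fin n → Fin n → Bool
fz   == fz   = true
fz   == fs _ = false
fs _ == fz   = false
fs x == fs y = x == y

==-refl : ∀ {n} (x : Fin n) → (x == x) ≡ true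
==-refl fz     = refl
==-refl (fs x) = ==-refl x

==-sound : ∀ {n} {x y : Fin n} → (x == y) ≡ true → x ≡ y
==-sound {x = fz}   {fz}   e = refl
==-sound {x = fs x} {fs y} e = cong fs (==-sound e)

==-sym : ∀ {n} (x y : Fin n) → (x == y) ≡ (y == x)
==-sym fz     fz     = refl
==-sym fz     (fs y) = refl
==-sym (fs x) fz     = refl
==-sym (fs x) (fs y) = ==-sym x y

==-false : ∀ {n} {x y : Fin n} → ¬ x ≡ y → (x == y) ≡ false
==-false {x = x} {y} x≢y with x == y in e
... | true  = ⊥-elim (x≢y (==-sound e))
... | false = refl

==-neq : ∀ {n} {x y : Fin n} → (x == y) ≡ false → ¬ x ≡ y
==-neq {x = x} e refl = true≢false (trans (sym (==-refl x)) e)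

⌊≟⌋≡== : ∀ {n} (x y : Fin n) → ⌊ x ≟ y ⌋ ≡ (x == y)
⌊≟⌋≡== x y with x ≟ y
... | yes refl = sym (==-refl x)
... | no  x≢y  = sym (==-false x≢y)

sumF-delta : ∀ {n} (w : Fin n) (g : Fin n → ℕ) → sumF (λ i → ind (i == w) * g i) ≡ g w
sumF-delta {suc n} fz g =
  trans (cong₂ _+_ (+-identityʳ (g fz)) (sumF-zero {n})) (+-identityʳ (g fz))
sumF-delta {suc n} (fs w) g = sumF-delta w (λ i → g (fs i))

sumF-point : ∀ {n} (w : Fin n) → sumF (λ i → ind (i == w)) ≡ 1
sumF-point {n} w = trans (sumF-ext {n} (λ i → sym (*-identityʳ _))) (sumF-delta w (λ _ → 1))

sum2 : ∀ {n} → (Fin n → Fin n → ℕ) → ℕ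
sum2 f = sumF (λ u → sumF (f u))

sum2-+ : ∀ {n} (f g : Fin n → Fin n → ℕ) → sum2 (λ u v → f u v + g u v) ≡ sum2 f + sum2 g
sum2-+ {n} f g = trans (sumF-ext {n} (λ u → sumF-+ (f u) (g u))) (sumF-+ {n} _ _)

sum2-mono : ∀ {n} {f g : Fin n → Fin n → ℕ} → (∀ u v → f u v ≤ g u v) → sum2 f ≤ sum2 g
sum2-mono {n} le = sumF-mono {n} (λ u → sumF-mono (le u))

sum2-row : ∀ {n} (w : Fin n) (f : Fin n → Fin n → ℕ) →
  sum2 (λ u v → ind (u == w) * f u v) ≡ sumF (f w)
sum2-row {n} w f = trans (sumF-ext {n} (λ u → sumF-* (ind (u == w)) (f u))) (sumF-delta w (λ u → sumF (f u)))

sum2-column : ∀ {n} (w : Fin n) (f : Fin n → Fin n → ℕ) →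
  sum2 (λ u v → ind (v == w) * f u v) ≡ sumF (λ u → f u w)
sum2-column {n} w f = sumF-ext {n} (λ u → sumF-delta w (f u))

sum2-ones : ∀ {n} → sum2 {n} (λ _ _ → 1) ≡ n * n
sum2-ones {n} = trans (sumF-ext {n} (λ _ → sumF-const {n} 1))
                      (trans (sumF-const {n} (n * 1)) (cong (n *_) (*-identityʳ n)))

count-insert : ∀ {n} (P : Fin n → Bool) b → P b ≡ false →
  count (λ z → (b == z) ∨ P z) ≡ suc (count P)
count-insert {suc n} P fz     e rewrite e = refl
count-insert {suc n} P (fs b) e =
  trans (cong (ind (P fz) +_) (count-insert (λ i → P (fs i)) b e)) (+-suc (ind (P fz)) _)

module _ {n : ℕ} (G : SimpleGraph n) where

  private
    A = adj G

    excl : ∀ a b → ind (a <ᵇ b) + ind (b <ᵇ a) ≤ 1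
    excl zero    zero    = z≤n
    excl zero    (suc b) = ≤-refl
    excl (suc a) zero    = ≤-refl
    excl (suc a) (suc b) = excl a b

    both : ∀ a p q → ind p + ind q ≤ 1 → ind (a ∧ p) + ind (a ∧ q) ≤ ind a
    both true  p q le = le
    both false p q le = z≤n

  deg≡sumF : ∀ u → deg G u ≡ sumF (λ v → ind (A u v))
  deg≡sumF u = count≡sumF (A u)

  handshake : edgeCount G + edgeCount G ≤ sumF (deg G)
  handshake = begin
    edgeCount G + edgeCount G
      ≡⟨ cong₂ _+_ up (trans up (trans (sumF-swap {n} {n} _) (sumF-ext {n} λ v → sumF-ext {n} λ u →
           cong (λ b → ind (b ∧ (toℕ u <ᵇ toℕ v))) (SimpleGraph.sym G u v)))) ⟩
    sum2 (λ u v → ind (A u v ∧ (toℕ u <ᵇ toℕ v)))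
      + sum2 (λ u v → ind (A u v ∧ (toℕ v <ᵇ toℕ u)))
      ≡⟨ sym (sum2-+ {n} _ _) ⟩
    sum2 (λ u v → ind (A u v ∧ (toℕ u <ᵇ toℕ v)) + ind (A u v ∧ (toℕ v <ᵇ toℕ u)))
      ≤⟨ sum2-mono (λ u v → both (A u v) _ _ (excl (toℕ u) (toℕ v))) ⟩
    sum2 (λ u v → ind (A u v))
      ≡⟨ sumF-ext {n} (λ u → sym (deg≡sumF u)) ⟩
    sumF (deg G) ∎
    where
    open ≤-Reasoning
    up : edgeCount G ≡ sum2 (λ u v → ind (A u v ∧ (toℕ u <ᵇ toℕ v)))
    up = sumF-ext {n} (λ u → count≡sumF {n} _)

  -- no loops, so a vertex has fewer than n neighbours
  deg<n : ∀ w → 1 + deg G w ≤ n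
  deg<n w = count-false (A w) w (irrefl G w)

  reachable⇒deg≥1 : ∀ {x y} → Reachable G x y → ¬ x ≡ y → 1 ≤ deg G x
  reachable⇒deg≥1 here       x≢y = ⊥-elim (x≢y refl)
  reachable⇒deg≥1 (there {v = z} axz _) _ = count-true (A _) z axz

  crossing : (P : Fin n → Bool) → ∀ {a c} → Reachable G a c → P a ≡ true → P c ≡ false →
    ∃ λ u → ∃ λ v → P u ≡ true × P v ≡ false × A u v ≡ true
  crossing P here            Pa Pc = ⊥-elim (true≢false (trans (sym Pa) Pc))
  crossing P {a} (there {v = y} ay r) Pa Pc with P y in Py
  ... | true  = crossing P r Py Pc
  ... | false = a , y , Pa , Py , ay

  some-edge : 1 ≤ edgeCount G → ∃ λ u → ∃ λ v → adj G u v ≡ true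
  some-edge m≥1 with sumF-pos _ m≥1
  ... | u , row≥1 with count-pos _ row≥1
  ...   | v , uv = u , v , ∧-true uv
    where
    ∧-true : ∀ {a b} → a ∧ b ≡ true → a ≡ true
    ∧-true {true} _ = refl

  edge-distinct : ∀ {u v} → adj G u v ≡ true → ¬ u ≡ v
  edge-distinct {u} uv refl = true≢false (trans (sym uv) (irrefl G u))

  two-vertices : ∀ {u v} → adj G u v ≡ true → 2 ≤ n
  two-vertices {u} {v} uv = distinct⇒2≤ u v (edge-distinct uv)
    where
    distinct⇒2≤ : ∀ {n} (u v : Fin n) → ¬ u ≡ v → 2 ≤ n
    distinct⇒2≤ {suc zero}    fz fz u≢v = ⊥-elim (u≢v refl)
    distinct⇒2≤ {suc (suc _)} _  _  _   = s≤s (s≤s z≤n)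

  connected⇒deg≥1 : Connected G → ∀ {u v} → adj G u v ≡ true → ∀ x → 1 ≤ deg G x
  connected⇒deg≥1 conn {u} {v} uv x with x ≟ u
  ... | yes refl = count-true (adj G x) v uv
  ... | no  x≢u  = reachable⇒deg≥1 (conn x u) x≢u

occ : ∀ {n} → Fin n → List (Fin n) → ℕ
occ v []       = 0
occ v (x ∷ xs) = ind (x == v) + occ v xs

occ-++ : ∀ {n} (v : Fin n) xs ys → occ v (xs ++ ys) ≡ occ v xs + occ v ys
occ-++ v []       ys = refl
occ-++ v (x ∷ xs) ys = trans (cong (ind (x == v) +_) (occ-++ v xs ys)) (sym (+-assoc (ind (x == v)) _ _))

length≡sumF-occ : ∀ {n} (xs : List (Fin n)) → length xs ≡ sumF (λ v → occ v xs)
length≡sumF-occ {n} []       = sym (sumF-zero {n})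
length≡sumF-occ {n} (x ∷ xs) =
  trans (cong₂ _+_ (sym (trans (sumF-ext {n} (λ v → cong ind (==-sym x v))) (sumF-point x)))
                   (length≡sumF-occ xs))
        (sym (sumF-+ (λ v → ind (x == v)) (λ v → occ v xs)))

-- A walk is written x ∷ ys: it starts at x and then steps to the vertices of
-- ys in turn.  `succs u x ys` lists, in order, the vertices the walk steps to
-- right after its visits to u, and `trav u v x ys` counts the traversals of the
-- directed edge u → v.
succs : ∀ {n} → Fin n → Fin n → List (Fin n) → List (Fin n)
succs u x []       = []
succs u x (y ∷ ys) = if x == u then y ∷ succs u y ys else succs u y ys

trav : ∀ {n} → Fin n → Fin n → Fin n → List (Fin n) → ℕ
trav u v x ys = occ v (succs u x ys)

trav-∷ : ∀ {n} (u v x y : Fin n) ys → trav u v x (y ∷ ys) ≡ ind ((x == u) ∧ (y == v)) + trav u v y ys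
trav-∷ u v x y ys with x == u
... | true  = refl
... | false = refl

-- Every step leaves exactly one vertex, so the walk's length is the total
-- number of traversals of directed edges.
length-succs : ∀ {n} (x : Fin n) ys → sumF (λ u → length (succs u x ys)) ≡ length ys
length-succs {n} x []       = sumF-zero {n}
length-succs {n} x (y ∷ ys) = begin
  sumF (λ u → length (succs u x (y ∷ ys)))  ≡⟨ sumF-ext {n} step ⟩
  sumF (λ u → ind (u == x) + length (succs u y ys))
    ≡⟨ sumF-+ {n} (λ u → ind (u == x)) _ ⟩
  sumF (λ u → ind (u == x)) + sumF (λ u → length (succs u y ys))
    ≡⟨ cong₂ _+_ (sumF-point x) (length-succs y ys) ⟩
  suc (length ys) ∎
  where
  open ≡-Reasoning
  step : ∀ u → length (succs u x (y ∷ ys)) ≡ ind (u == x) + length (succs u y ys)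
  step u rewrite ==-sym u x with x == u
  ... | true  = refl
  ... | false = refl

length≡sum2-trav : ∀ {n} (x : Fin n) ys → length ys ≡ sum2 (λ u v → trav u v x ys)
length≡sum2-trav {n} x ys =
  trans (sym (length-succs x ys)) (sumF-ext {n} (λ u → length≡sumF-occ (succs u x ys)))

Walk : ∀ {n} → (Fin n → Fin n → Bool) → Fin n → List (Fin n) → Set
Walk A x []       = ⊤
Walk A x (y ∷ ys) = A x y ≡ true × Walk A y ys

trav-adj : ∀ {n} (A : Fin n → Fin n → Bool) {u v} x ys → Walk A x ys →
  1 ≤ trav u v x ys → A u v ≡ true
trav-adj A {u} {v} x (y ∷ ys) (axy , w) h rewrite trav-∷ u v x y ys with x == u in e1 | y == v in e2
... | true  | true = subst₂ (λ p q → A p q ≡ true) (==-sound e1) (==-sound e2) axy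
... | true  | false = trav-adj A y ys w h
... | false | _     = trav-adj A y ys w h

trav-visits : ∀ {n} {u v : Fin n} x ys → 1 ≤ trav u v x ys → 1 ≤ occ u (x ∷ ys)
trav-visits {u = u} {v} x (y ∷ ys) h rewrite trav-∷ u v x y ys with x == u
... | true  = s≤s z≤n
... | false = trav-visits y ys h

-- `detour a b x ys` is the tail of the walk obtained from x ∷ ys by inserting
-- the excursion a → b → a right after the first visit of a.
detour : ∀ {n} → Fin n → Fin n → Fin n → List (Fin n) → List (Fin n)
detour a b x ys with x == a
detour a b x ys       | true  = b ∷ a ∷ ys
detour a b x []       | false = []
detour a b x (y ∷ ys) | false = y ∷ detour a b y ys

excursion : ∀ {n} → Fin n → Fin n → Fin n → Fin n → ℕ
excursion a b u v = ind ((a == u) ∧ (b == v)) + ind ((b == u) ∧ (a == v))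

module _ {n : ℕ} (a b : Fin n) where

  trav-detour : ∀ u v x ys → 1 ≤ occ a (x ∷ ys) →
    trav u v x (detour a b x ys) ≡ excursion a b u v + trav u v x ys
  trav-detour u v x ys h with x == a in e
  ... | true with refl ← ==-sound {x = x} {a} e =
    trans (trav-∷ u v a b (a ∷ ys))
          (trans (cong (ind ((a == u) ∧ (b == v)) +_) (trav-∷ u v b a ys))
                (sym (+-assoc (ind ((a == u) ∧ (b == v))) (ind ((b == u) ∧ (a == v))) (trav u v a ys))))
  trav-detour u v x (y ∷ ys) h | false = begin
    trav u v x (y ∷ detour a b y ys)
      ≡⟨ trav-∷ u v x y (detour a b y ys) ⟩
    ind ((x == u) ∧ (y == v)) + trav u v y (detour a b y ys)
      ≡⟨ cong (ind ((x == u) ∧ (y == v)) +_) (trav-detour u v y ys h) ⟩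
    ind ((x == u) ∧ (y == v)) + (excursion a b u v + trav u v y ys)
      ≡⟨ x∙yz≈y∙xz (ind ((x == u) ∧ (y == v))) (excursion a b u v) (trav u v y ys) ⟩
    excursion a b u v + (ind ((x == u) ∧ (y == v)) + trav u v y ys)
      ≡⟨ cong (excursion a b u v +_) (sym (trav-∷ u v x y ys)) ⟩
    excursion a b u v + trav u v x (y ∷ ys) ∎
    where open ≡-Reasoning

  occ-detour : ∀ z x ys → 1 ≤ occ a (x ∷ ys) →
    occ z (detour a b x ys) ≡ ind (b == z) + ind (a == z) + occ z ys
  occ-detour z x ys h with x == a
  ... | true = sym (+-assoc (ind (b == z)) _ _)
  occ-detour z x (y ∷ ys) h | false =
    trans (cong (ind (y == z) +_) (occ-detour z y ys h))
          (x∙yz≈y∙xz (ind (y == z)) (ind (b == z) + ind (a == z)) (occ z ys))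

  length-detour : ∀ x ys → 1 ≤ occ a (x ∷ ys) → length (detour a b x ys) ≡ 2 + length ys
  length-detour x ys h with x == a
  ... | true = refl
  length-detour x (y ∷ ys) h | false = cong suc (length-detour y ys h)

  walk-detour : ∀ (A : Fin n → Fin n → Bool) x ys → A a b ≡ true → A b a ≡ true →
    Walk A x ys → 1 ≤ occ a (x ∷ ys) → Walk A x (detour a b x ys)
  walk-detour A x ys ab ba w h with x == a in e
  ... | true with refl ← ==-sound {x = x} {a} e = ab , ba , w
  walk-detour A x (y ∷ ys) ab ba (xy , w) h | false = xy , walk-detour A y ys ab ba w h

nth : ∀ {A : Set} → A → List A → ℕ → A
nth d []       j       = d
nth d (x ∷ xs) zero    = x
nth d (x ∷ xs) (suc j) = nth d xs j

nth-++ˡ : ∀ {A : Set} (d : A) xs ys j → j < length xs → nth d (xs ++ ys) j ≡ nth d xs j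
nth-++ˡ d (x ∷ xs) ys zero    h = refl
nth-++ˡ d (x ∷ xs) ys (suc j) h = nth-++ˡ d xs ys j (s≤s⁻¹ h)

occ-nth : ∀ {n} (d x : Fin n) zs r → r ≤ length zs → 1 ≤ occ (nth d (x ∷ zs) r) (x ∷ zs)
occ-nth d x zs       zero    _ rewrite ==-refl x = s≤s z≤n
occ-nth d x (y ∷ zs) (suc r) h =
  ≤-trans (occ-nth d y zs r (s≤s⁻¹ h)) (m≤n+m _ (ind (x == nth d (y ∷ zs) r)))

count-nth : ∀ {n L} (d v : Fin n) xs → length xs ≡ L →
  count {L} (λ i → nth d xs (toℕ i) == v) ≡ occ v xs
count-nth d v []       refl = refl
count-nth d v (x ∷ xs) refl = cong (ind (x == v) +_) (count-nth d v xs refl)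

rep : ∀ {A : Set} → ℕ → List A → List A
rep zero    xs = []
rep (suc k) xs = xs ++ rep k xs

length-rep : ∀ {A : Set} k (xs : List A) → length (rep k xs) ≡ k * length xs
length-rep zero    xs = refl
length-rep (suc k) xs = trans (length-++ xs) (cong (length xs +_) (length-rep k xs))

nth-rep : ∀ {A : Set} (d : A) c xs j → 1 ≤ c → j < length xs → nth d (rep c xs) j ≡ nth d xs j
nth-rep d (suc c) xs j _ j<xs = nth-++ˡ d xs (rep c xs) j j<xs

occ-rep : ∀ {n} k (v : Fin n) xs → occ v (rep k xs) ≡ k * occ v xs
occ-rep zero    v xs = refl
occ-rep (suc k) v xs = trans (occ-++ v xs (rep k xs)) (cong (occ v xs +_) (occ-rep k v xs))

listOf : ∀ {n} → (Fin n → Bool) → List (Fin n)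
listOf {zero}  p = []
listOf {suc n} p = if p fz then fz ∷ rest else rest
  where rest = map fs (listOf (λ i → p (fs i)))

occ-map-fs : ∀ {n} (v : Fin n) xs → occ (fs v) (map fs xs) ≡ occ v xs
occ-map-fs v []       = refl
occ-map-fs v (x ∷ xs) = cong (ind (x == v) +_) (occ-map-fs v xs)

occ-fz-map-fs : ∀ {n} (xs : List (Fin n)) → occ fz (map fs xs) ≡ 0
occ-fz-map-fs []       = refl
occ-fz-map-fs (x ∷ xs) = occ-fz-map-fs xs

occ-listOf : ∀ {n} (p : Fin n → Bool) v → occ v (listOf p) ≡ ind (p v)
occ-listOf {suc n} p fz with p fz
... | true  = cong suc (occ-fz-map-fs (listOf (λ i → p (fs i))))
... | false = occ-fz-map-fs (listOf (λ i → p (fs i)))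
occ-listOf {suc n} p (fs w) with p fz
... | true  = trans (occ-map-fs w (listOf (λ i → p (fs i)))) (occ-listOf (λ i → p (fs i)) w)
... | false = trans (occ-map-fs w (listOf (λ i → p (fs i)))) (occ-listOf (λ i → p (fs i)) w)

module RotorMechanics {n : ℕ} (G : SimpleGraph n) (k : Fin n → ℕ) where
  open Rotor G k

  advance^ : ∀ {L} → ℕ → Fin L → Fin L
  advance^ zero    i = i
  advance^ (suc j) i = advance^ j (advance i)

  toℕ-advance : ∀ {L} (i : Fin L) → suc (toℕ i) < L → toℕ (advance i) ≡ suc (toℕ i)
  toℕ-advance {suc L} i h = trans (toℕ-fromℕ< (m%n<n (suc (toℕ i)) (suc L))) (m<n⇒m%n≡m h)

  toℕ-advance^ : ∀ j {L} (i : Fin L) → toℕ i + j < L → toℕ (advance^ j i) ≡ toℕ i + j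
  toℕ-advance^ zero    i h = sym (+-identityʳ (toℕ i))
  toℕ-advance^ (suc j) {L} i h = begin
    toℕ (advance^ j (advance i))
      ≡⟨ toℕ-advance^ j (advance i) (subst (λ q → q + j < L) (sym once) h′) ⟩
    toℕ (advance i) + j          ≡⟨ cong (_+ j) once ⟩
    suc (toℕ i) + j              ≡⟨ sym (+-suc (toℕ i) j) ⟩
    toℕ i + suc j                ∎
    where
    open ≡-Reasoning
    h′ : suc (toℕ i) + j < L
    h′ = subst (_< L) (+-suc (toℕ i) j) h
    once : toℕ (advance i) ≡ suc (toℕ i)
    once = toℕ-advance i (≤-trans (s≤s (s≤s (m≤m+n (toℕ i) j))) h′)

  walkState-suc : ∀ σ s t → walkState σ s (suc t) ≡ walkState σ (step σ s) t
  walkState-suc σ s zero    = refl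
  walkState-suc σ s (suc t) = cong (step σ) (walkState-suc σ s t)

-- A walk x₀ ∷ ys in G that traverses every directed
-- edge at most once is the beginning of a rotor walk: list at each vertex u
-- first its successors along the walk, then its remaining neighbours, and
-- repeat this list k u times.  Started at x₀ with all rotors at index 0,
-- the rotor walk follows x₀ ∷ ys.
module Realisation {n : ℕ} (G : SimpleGraph n) (k : Fin n → ℕ) (k≥1 : ∀ u → 1 ≤ k u)
  (deg≥1 : ∀ u → 1 ≤ deg G u) (x₀ : Fin n) (ys : List (Fin n))
  (walk : Walk (adj G) x₀ ys) (trail : ∀ u v → trav u v x₀ ys ≤ 1) where

  open Rotor G k
  open RotorMechanics G k

  unused : Fin n → List (Fin n)
  unused u = listOf (λ z → adj G u z ∧ not (0 <ᵇ trav u z x₀ ys))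

  nbrs : Fin n → List (Fin n)
  nbrs u = succs u x₀ ys ++ unused u

  occ-nbrs : ∀ u v → occ v (nbrs u) ≡ ind (adj G u v)
  occ-nbrs u v
    rewrite occ-++ v (succs u x₀ ys) (unused u)
          | occ-listOf (λ z → adj G u z ∧ not (0 <ᵇ trav u z x₀ ys)) v
    with trav u v x₀ ys in t | trail u v
  ... | zero     | _ = cong ind (∧-identityʳ (adj G u v))
  ... | suc zero | _ rewrite trav-adj (adj G) x₀ ys walk (subst (1 ≤_) (sym t) ≤-refl) = refl
  ... | suc (suc _) | s≤s ()

  length-nbrs : ∀ u → length (nbrs u) ≡ deg G u
  length-nbrs u = trans (length≡sumF-occ (nbrs u))
                        (trans (sumF-ext {n} (occ-nbrs u)) (sym (count≡sumF (adj G u))))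

  rotorList : Fin n → List (Fin n)
  rotorList u = rep (k u) (nbrs u)

  length-rotorList : ∀ u → length (rotorList u) ≡ len u
  length-rotorList u = trans (length-rep (k u) (nbrs u)) (cong (k u *_) (length-nbrs u))

  σ : RotorSeqs
  σ u i = nth x₀ (rotorList u) (toℕ i)

  valid : ValidSeqs σ
  valid u v = begin
    count (λ i → ⌊ σ u i ≟ v ⌋)   ≡⟨ count-ext (λ i → ⌊≟⌋≡== (σ u i) v) ⟩
    count (λ i → σ u i == v)      ≡⟨ count-nth x₀ v (rotorList u) (length-rotorList u) ⟩
    occ v (rotorList u)           ≡⟨ occ-rep (k u) v (nbrs u) ⟩
    k u * occ v (nbrs u)          ≡⟨ cong (k u *_) (occ-nbrs u v) ⟩
    k u * ind (adj G u v)         ≡⟨ k*ind (adj G u v) ⟩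
    (if adj G u v then k u else 0) ∎
    where
    open ≡-Reasoning
    k*ind : ∀ b → k u * ind b ≡ (if b then k u else 0)
    k*ind true  = *-identityʳ (k u)
    k*ind false = *-zeroʳ (k u)

  ρ₀ : Positions
  ρ₀ u = fromℕ< (*-mono-≤ (k≥1 u) (deg≥1 u))

  Spells : (u : Fin n) → Fin (len u) → List (Fin n) → Set
  Spells u i L = ∀ j → j < length L → σ u (advance^ j i) ≡ nth x₀ L j

  -- The invariant of the simulation, when the walk still has to perform the
  -- steps x ∷ zs: every rotor spells the remaining successors of its vertex.
  Upcoming : Positions → Fin n → List (Fin n) → Set
  Upcoming ρ x zs = ∀ u → Spells u (ρ u) (succs u x zs)

  upcoming₀ : Upcoming ρ₀ x₀ ys
  upcoming₀ u j j<S = begin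
    nth x₀ (rotorList u) (toℕ (advance^ j (ρ₀ u))) ≡⟨ cong (nth x₀ (rotorList u)) index ⟩
    nth x₀ (rep (k u) (nbrs u)) j                  ≡⟨ nth-rep x₀ (k u) (nbrs u) j (k≥1 u) j<nbrs ⟩
    nth x₀ (nbrs u) j                              ≡⟨ nth-++ˡ x₀ (succs u x₀ ys) (unused u) j j<S ⟩
    nth x₀ (succs u x₀ ys) j                       ∎
    where
    open ≡-Reasoning
    j<nbrs : j < length (nbrs u)
    j<nbrs = ≤-trans j<S (≤-trans (m≤m+n _ (length (unused u)))
                                  (≤-reflexive (sym (length-++ (succs u x₀ ys)))))
    j<len : j < len u
    j<len = ≤-trans j<nbrs (subst (_≤ len u) (trans (*-identityˡ (deg G u)) (sym (length-nbrs u)))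
                                     (*-monoˡ-≤ (deg G u) (k≥1 u)))
    index : toℕ (advance^ j (ρ₀ u)) ≡ j
    index = trans (toℕ-advance^ j (ρ₀ u) (subst (λ q → q + j < len u) (sym zero-index) j<len))
                  (cong (_+ j) zero-index)
      where zero-index = toℕ-fromℕ< (*-mono-≤ (k≥1 u) (deg≥1 u))

  succs-here : ∀ (x y : Fin n) zs → succs x x (y ∷ zs) ≡ y ∷ succs x y zs
  succs-here x y zs rewrite ==-refl x = refl

  succs-elsewhere : ∀ (u x y : Fin n) zs → (x == u) ≡ false → succs u x (y ∷ zs) ≡ succs u y zs
  succs-elsewhere u x y zs e rewrite e = refl

  -- A step from x to y consumes the first upcoming successor of x.  The
  -- case split on u ≟ x is the one advanceAt performs, so positions compute.
  upcoming-step : ∀ ρ x y zs → Upcoming ρ x (y ∷ zs) → Upcoming (advanceAt x ρ) y zs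
  upcoming-step ρ x y zs up u with u ≟ x
  ... | yes refl =
    λ j j<S → subst (Spells u (ρ u)) (succs-here u y zs) (up u) (suc j) (s≤s j<S)
  ... | no u≢x =
    subst (Spells u (ρ u)) (succs-elsewhere u x y zs (==-false (λ x≡u → u≢x (sym x≡u)))) (up u)

  follows : ∀ r x zs ρ → Upcoming ρ x zs → r ≤ length zs →
    position σ (x , ρ) r ≡ nth x₀ (x ∷ zs) r
  follows zero    x zs       ρ up h = refl
  follows (suc r) x (y ∷ zs) ρ up h = begin
    position σ (x , ρ) (suc r)
      ≡⟨ cong proj₁ (walkState-suc σ (x , ρ) r) ⟩
    position σ (σ x (ρ x) , advanceAt x ρ) r
      ≡⟨ cong (λ z → position σ (z , advanceAt x ρ) r) first ⟩
    position σ (y , advanceAt x ρ) r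
      ≡⟨ follows r y zs _ (upcoming-step ρ x y zs up) (s≤s⁻¹ h) ⟩
    nth x₀ (y ∷ zs) r ∎
    where
    open ≡-Reasoning
    first : σ x (ρ x) ≡ y
    first = subst (Spells x (ρ x)) (succs-here x y zs) (up x) 0 (s≤s z≤n)

  follows-trail : ∀ r → r ≤ length ys → position σ (x₀ , ρ₀) r ≡ nth x₀ (x₀ ∷ ys) r
  follows-trail r = follows r x₀ ys ρ₀ upcoming₀

-- Starting from the empty walk at x₀ we repeatedly insert an
-- excursion a → b → a along an edge that has not been traversed yet, where a
-- is already visited; if b is new, the trail has paid two steps for it.
module Growth {n : ℕ} (G : SimpleGraph n) (x₀ : Fin n) where

  private
    A = adj G

  Visited : Fin n → List (Fin n) → Bool
  Visited z ys = 0 <ᵇ occ z (x₀ ∷ ys)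

  visitedCount : List (Fin n) → ℕ
  visitedCount ys = count (λ z → Visited z ys)

  record GoodTrail (ys : List (Fin n)) : Set where
    field
      walk      : Walk A x₀ ys
      trail     : ∀ u v → trav u v x₀ ys ≤ 1
      symmetric : ∀ u v → trav u v x₀ ys ≡ trav v u x₀ ys
      -- every vertex besides x₀ was paid for with two steps
      cheap     : visitedCount ys + visitedCount ys ≤ 2 + length ys
      unvisited : 1 + visitedCount ys ≤ n
  open GoodTrail

  length-bound : ∀ ys → GoodTrail ys → length ys ≤ n * n
  length-bound ys g = begin
    length ys                 ≡⟨ length≡sum2-trav x₀ ys ⟩
    sum2 (λ u v → trav u v x₀ ys) ≤⟨ sum2-mono {n} (trail g) ⟩
    sum2 {n} (λ _ _ → 1)      ≡⟨ sum2-ones {n} ⟩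
    n * n                     ∎
    where open ≤-Reasoning

  module Excursion (ys : List (Fin n)) (g : GoodTrail ys) (a b : Fin n)
                   (a-visited : Visited a ys ≡ true) (ab : A a b ≡ true)
                   (ab-new : trav a b x₀ ys ≡ 0) where

    ys′ : List (Fin n)
    ys′ = detour a b x₀ ys

    a-occurs : 1 ≤ occ a (x₀ ∷ ys)
    a-occurs = 0<ᵇ⇒1≤ a-visited

    ba-new : trav b a x₀ ys ≡ 0
    ba-new = trans (sym (symmetric g a b)) ab-new

    a≢b : ¬ a ≡ b
    a≢b = edge-distinct G ab

    trav′ : ∀ u v → trav u v x₀ ys′ ≡ excursion a b u v + trav u v x₀ ys
    trav′ u v = trav-detour a b u v x₀ ys a-occurs

    walk′ : Walk A x₀ ys′
    walk′ = walk-detour a b A x₀ ys ab (trans (SimpleGraph.sym G b a) ab) (walk g) a-occurs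

    length′ : length ys′ ≡ 2 + length ys
    length′ = length-detour a b x₀ ys a-occurs

    symmetric′ : ∀ u v → trav u v x₀ ys′ ≡ trav v u x₀ ys′
    symmetric′ u v rewrite trav′ u v | trav′ v u = cong₂ _+_ swap (symmetric g u v)
      where
      swap : excursion a b u v ≡ excursion a b v u
      swap = trans (+-comm (ind ((a == u) ∧ (b == v))) _)
                   (cong₂ _+_ (cong ind (∧-comm (b == u) (a == v))) (cong ind (∧-comm (a == u) (b == v))))

    -- both directions of the edge were untraversed, so nothing is traversed twice
    trail′ : ∀ u v → trav u v x₀ ys′ ≤ 1
    trail′ u v rewrite trav′ u v with a == u in au | b == v in bv
    ... | true | true with refl ← ==-sound {x = a} {u} au | refl ← ==-sound {x = b} {v} bv
      rewrite ==-false {x = b} {a} (λ b≡a → a≢b (sym b≡a)) | ab-new = ≤-refl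
    ... | true | false with refl ← ==-sound {x = a} {u} au
      rewrite ==-false {x = b} {a} (λ b≡a → a≢b (sym b≡a)) = trail g u v
    ... | false | _ with b == u in bu | a == v in av
    ...   | true  | true with refl ← ==-sound {x = b} {u} bu | refl ← ==-sound {x = a} {v} av
      rewrite ba-new = ≤-refl
    ...   | true  | false = trail g u v
    ...   | false | _     = trail g u v

    visited′ : ∀ z → Visited z ys′ ≡ (b == z) ∨ ((a == z) ∨ Visited z ys)
    visited′ z = begin
      0 <ᵇ (ind (x₀ == z) + occ z ys′)
        ≡⟨ cong (λ o → 0 <ᵇ (ind (x₀ == z) + o)) (occ-detour a b z x₀ ys a-occurs) ⟩
      0 <ᵇ (i₀ + (ind (b == z) + ind (a == z) + occ z ys))
        ≡⟨ cong (0 <ᵇ_) (trans (x∙yz≈y∙xz i₀ (ind (b == z) + ind (a == z)) _)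
                               (+-assoc (ind (b == z)) _ _)) ⟩
      0 <ᵇ (ind (b == z) + (ind (a == z) + (i₀ + occ z ys)))
        ≡⟨ 0<ᵇ-+ (ind (b == z)) _ ⟩
      (0 <ᵇ ind (b == z)) ∨ (0 <ᵇ (ind (a == z) + (i₀ + occ z ys)))
        ≡⟨ cong₂ _∨_ (0<ᵇ-ind (b == z))
                     (trans (0<ᵇ-+ (ind (a == z)) _) (cong (_∨ Visited z ys) (0<ᵇ-ind (a == z)))) ⟩
      (b == z) ∨ ((a == z) ∨ Visited z ys) ∎
      where
      open ≡-Reasoning
      i₀ = ind (x₀ == z)

    absorb : ∀ c → Visited c ys ≡ true → ∀ z → ((c == z) ∨ Visited z ys) ≡ Visited z ys
    absorb c c-visited z with c == z in e
    ... | true with refl ← ==-sound {x = c} {z} e = sym c-visited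
    ... | false = refl

    inside : Visited b ys ≡ true → GoodTrail ys′
    inside b-visited = record
      { walk = walk′ ; trail = trail′ ; symmetric = symmetric′
      ; cheap = subst (λ c → c + c ≤ 2 + length ys′) (sym same)
                      (≤-trans (cheap g) (+-monoʳ-≤ 2 (≤-trans (m≤n+m (length ys) 2)
                                                            (≤-reflexive (sym length′)))))
      ; unvisited = subst (λ c → 1 + c ≤ n) (sym same) (unvisited g) }
      where
      same : visitedCount ys′ ≡ visitedCount ys
      same = count-ext (λ z → trans (visited′ z)
               (trans (cong ((b == z) ∨_) (absorb a a-visited z)) (absorb b b-visited z)))

    outside : Visited b ys ≡ false → 2 + visitedCount ys ≤ n → GoodTrail ys′
    outside b-new room = record
      { walk = walk′ ; trail = trail′ ; symmetric = symmetric′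
      ; cheap = subst (λ c → c + c ≤ 2 + length ys′) (sym one-more) cheap′
      ; unvisited = subst (λ c → 1 + c ≤ n) (sym one-more) room }
      where
      one-more : visitedCount ys′ ≡ suc (visitedCount ys)
      one-more = trans (count-ext (λ z → trans (visited′ z) (cong ((b == z) ∨_) (absorb a a-visited z))))
                       (count-insert (λ z → Visited z ys) b b-new)
      cheap′ : suc (visitedCount ys) + suc (visitedCount ys) ≤ 2 + length ys′
      cheap′ rewrite +-suc (visitedCount ys) (visitedCount ys) | length′ = +-monoʳ-≤ 2 (cheap g)

  x₀-visited : ∀ ys → Visited x₀ ys ≡ true
  x₀-visited ys rewrite ==-refl x₀ = refl

  untraversed-to-new : ∀ ys → GoodTrail ys → ∀ a b → Visited b ys ≡ false → trav a b x₀ ys ≡ 0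
  untraversed-to-new ys g a b b-new with trav a b x₀ ys in t
  ... | zero  = refl
  ... | suc _ = ⊥-elim (true≢false (trans (sym (1≤⇒0<ᵇ (trav-visits x₀ ys ba))) b-new))
    where
    ba : 1 ≤ trav b a x₀ ys
    ba = subst (1 ≤_) (trans (sym t) (symmetric g a b)) (s≤s z≤n)

  start : 2 ≤ n → GoodTrail []
  start n≥2 = record
    { walk = tt ; trail = λ _ _ → z≤n ; symmetric = λ _ _ → refl
    ; cheap = ≤-reflexive (cong (λ c → c + c) one)
    ; unvisited = subst (λ c → 1 + c ≤ n) (sym one) n≥2 }
    where
    only-x₀ : ∀ z → Visited z [] ≡ ((x₀ == z) ∨ false)
    only-x₀ z with x₀ == z
    ... | true  = refl
    ... | false = refl
    one : visitedCount [] ≡ 1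
    one = trans (count-ext only-x₀)
                (trans (count-insert (λ _ → false) x₀ refl)
                       (cong suc (trans (count≡sumF {n} _) (sumF-zero {n}))))

  Saturated : List (Fin n) → Set
  Saturated ys = ∀ u v → Visited u ys ≡ true → Visited v ys ≡ true → A u v ≡ true →
    1 ≤ trav u v x₀ ys

  Finished : List (Fin n) → Set
  Finished ys = GoodTrail ys × Saturated ys × n ≤ 1 + visitedCount ys

  Extension : List (Fin n) → Set
  Extension ys = ∃ λ ys′ → GoodTrail ys′ × length ys′ ≡ 2 + length ys

  Untraversed : List (Fin n) → Fin n → Fin n → Set
  Untraversed ys u v = Visited u ys ≡ true × Visited v ys ≡ true × A u v ≡ true × trav u v x₀ ys ≡ 0

  untraversed? : ∀ ys → Dec (∃ λ u → ∃ λ v → Untraversed ys u v)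
  untraversed? ys = any? λ u → any? λ v →
    (Visited u ys Bool.≟ true) ×-dec (Visited v ys Bool.≟ true) ×-dec
    (A u v Bool.≟ true) ×-dec (trav u v x₀ ys ℕ.≟ 0)

  -- One round of growth: traverse an untraversed edge inside the visited set;
  -- failing that, cross into a new vertex unless only one is left.
  extend-or-finish : Connected G → ∀ ys → GoodTrail ys → Finished ys ⊎ Extension ys
  extend-or-finish conn ys g with untraversed? ys
  ... | yes (a , b , a-visited , b-visited , ab , ab-new) =
    inj₂ (ys′ , inside b-visited , length′)
    where open Excursion ys g a b a-visited ab ab-new
  ... | no none with 2 + visitedCount ys ≤? n
  ...   | no full = inj₁ (g , saturated , ≤-pred (≰⇒> full))
    where
    saturated : Saturated ys
    saturated u v u-visited v-visited uv with trav u v x₀ ys in t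
    ... | zero  = ⊥-elim (none (u , v , u-visited , v-visited , uv , t))
    ... | suc _ = s≤s z≤n
  ...   | yes room with count-lt (λ z → Visited z ys) (≤-trans (n≤1+n _) room)
  ...     | c , c-new with crossing G (λ z → Visited z ys) (conn x₀ c) (x₀-visited ys) c-new
  ...       | a , b , a-visited , b-new , ab =
    inj₂ (ys′ , outside b-new room , length′)
    where open Excursion ys g a b a-visited ab (untraversed-to-new ys g a b b-new)

  -- Iterating, with a fuel budget large enough by length-bound.
  grow : Connected G → ∀ fuel ys → GoodTrail ys → n * n ≤ length ys + fuel → ∃ Finished
  grow conn fuel ys g budget with extend-or-finish conn ys g
  ... | inj₁ finished = ys , finished
  grow conn zero ys g budget | inj₂ (ys′ , g′ , length′) = ⊥-elim (1+n≰n too-long)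
    where
    open ≤-Reasoning
    too-long : suc (length ys) ≤ length ys
    too-long = begin
      suc (length ys) ≤⟨ n≤1+n _ ⟩
      2 + length ys   ≡⟨ sym length′ ⟩
      length ys′      ≤⟨ length-bound ys′ g′ ⟩
      n * n           ≤⟨ budget ⟩
      length ys + 0   ≡⟨ +-identityʳ (length ys) ⟩
      length ys       ∎
  grow conn (suc fuel) ys g budget | inj₂ (ys′ , g′ , length′) = grow conn fuel ys′ g′ (begin
    n * n                  ≤⟨ budget ⟩
    length ys + suc fuel   ≡⟨ +-suc (length ys) fuel ⟩
    suc (length ys + fuel) ≤⟨ n≤1+n _ ⟩
    2 + length ys + fuel   ≡⟨ cong (_+ fuel) (sym length′) ⟩
    length ys′ + fuel      ∎)
    where open ≤-Reasoning

  -- In a finished trail missing w, every edge away from w is traversed in both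
  -- directions, so 2m ≤ length + 2 deg w; and deg w is at most the number of
  -- visited vertices, which the trail has paid for: m ≤ 1 + length.
  finished-bound : ∀ ys → Finished ys → ∃ λ w → Visited w ys ≡ false × edgeCount G ≤ 1 + length ys
  finished-bound ys (g , saturated , full) with count-lt (λ z → Visited z ys) (unvisited g)
  ... | w , w-new = w , w-new , halve (edgeCount G) (1 + length ys) (begin
    edgeCount G + edgeCount G                  ≤⟨ handshake G ⟩
    sumF (deg G)                               ≡⟨ sumF-ext {n} (deg≡sumF G) ⟩
    sum2 (λ u v → ind (A u v))                 ≤⟨ sum2-mono {n} covered ⟩
    sum2 (λ u v → trav u v x₀ ys + (row u v + column u v))
      ≡⟨ trans (sum2-+ {n} _ _) (cong (sum2 (λ u v → trav u v x₀ ys) +_) (sum2-+ {n} row column)) ⟩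
    sum2 (λ u v → trav u v x₀ ys) + (sum2 row + sum2 column)
      ≡⟨ cong₂ _+_ (sym (length≡sum2-trav x₀ ys)) (cong₂ _+_ row-sum column-sum) ⟩
    length ys + (deg G w + deg G w)            ≤⟨ +-monoʳ-≤ (length ys) (+-mono-≤ deg≤visited deg≤visited) ⟩
    length ys + (visitedCount ys + visitedCount ys) ≤⟨ +-monoʳ-≤ (length ys) (cheap g) ⟩
    length ys + (2 + length ys)                ≡⟨ +-suc (length ys) (1 + length ys) ⟩
    (1 + length ys) + (1 + length ys)          ∎)
    where
    open ≤-Reasoning
    row column : Fin n → Fin n → ℕ
    row    u v = ind (u == w) * ind (A u v)
    column u v = ind (v == w) * ind (A u v)

    others-visited : ∀ z → ¬ z ≡ w → Visited z ys ≡ true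
    others-visited z z≢w with Visited z ys in z-new
    ... | true  = refl
    ... | false =
      ⊥-elim (1+n≰n (≤-trans (count-false₂ (λ x → Visited x ys) z w z≢w z-new w-new) full))

    covered : ∀ u v → ind (A u v) ≤ trav u v x₀ ys + (row u v + column u v)
    covered u v with A u v in uv | u == w in uw | v == w in vw
    ... | false | _     | _     = z≤n
    ... | true  | true  | _     = ≤-trans (s≤s z≤n) (m≤n+m _ (trav u v x₀ ys))
    ... | true  | false | true  = m≤n+m _ (trav u v x₀ ys)
    ... | true  | false | false =
      ≤-trans (saturated u v (others-visited u (==-neq uw)) (others-visited v (==-neq vw)) uv)
              (m≤m+n _ 0)

    row-sum : sum2 row ≡ deg G w
    row-sum = trans (sum2-row w (λ u v → ind (A u v))) (sym (deg≡sumF G w))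

    column-sum : sum2 column ≡ deg G w
    column-sum = trans (sum2-column w (λ u v → ind (A u v)))
                       (trans (sumF-ext {n} (λ u → cong ind (SimpleGraph.sym G u w))) (sym (deg≡sumF G w)))

    deg≤visited : deg G w ≤ visitedCount ys
    deg≤visited = s≤s⁻¹ (≤-trans (deg<n G w) full)

module _ {n : ℕ} (G : SimpleGraph n) where

  VCAtLeast-mono : ∀ k {c c′} → c ≤ c′ → VCAtLeast G k c′ → VCAtLeast G k c
  VCAtLeast-mono k c≤c′ (σ , valid , s , uncovered) =
    σ , valid , s , λ t t<c → uncovered t (≤-trans t<c c≤c′)

  -- The cover time of a connected graph with m ≥ 1 edges is at least m: grow a
  -- finished trail from an endpoint x₀ of some edge, realise it as a rotor walk,
  -- and observe that the walk does not reach the vertex the trail misses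
  -- within its first 1 + length ys ≥ m positions.
  cover-time-≥-edges : Connected G → 1 ≤ edgeCount G →
    (k : Fin n → ℕ) → (∀ u → 1 ≤ k u) → VCAtLeast G k (edgeCount G)
  cover-time-≥-edges conn m≥1 k k≥1 with some-edge G m≥1
  ... | x₀ , _ , x₀v
    with Growth.grow G x₀ conn (n * n) [] (Growth.start G x₀ (two-vertices G x₀v)) ≤-refl
  ...   | ys , finished with Growth.finished-bound G x₀ ys finished
  ...     | w , w-missed , m≤1+L = σ , valid , (x₀ , ρ₀) , uncovered
    where
    open Growth G x₀ using (Visited; GoodTrail)
    g = proj₁ finished
    open Realisation G k k≥1 (connected⇒deg≥1 G conn x₀v) x₀ ys (GoodTrail.walk g) (GoodTrail.trail g)
    open Rotor G k using (CoveredBy)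

    uncovered : ∀ t → t < edgeCount G → ¬ CoveredBy σ (x₀ , ρ₀) t
    uncovered t t<m covered with covered w
    ... | r , r≤t , r-at-w = true≢false (trans (sym visits-w) w-missed)
      where
      r≤L : r ≤ length ys
      r≤L = s≤s⁻¹ (≤-trans (s≤s r≤t) (≤-trans t<m m≤1+L))
      visits-w : Visited w ys ≡ true
      visits-w = subst (λ z → Visited z ys ≡ true) (trans (sym (follows-trail r r≤L)) r-at-w)
                       (1≤⇒0<ᵇ (occ-nth x₀ x₀ ys r r≤L))

theorem4p1 : (n : ℕ) (G : SimpleGraph n) → Connected G →
    (m δ : ℕ) → m ≡ edgeCount G → IsMinDegree G δ →
    (k : Fin n → ℕ) → (∀ u → 1 ≤ k u) →
    1 ≤ m ∸ δ → VCAtLeast G k (m ∸ δ)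
theorem4p1 n G conn m δ refl _ k k≥1 gap =
  VCAtLeast-mono G k (m∸n≤m m δ) (cover-time-≥-edges G conn (≤-trans gap (m∸n≤m m δ)) k k≥1)
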